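{- Assume the setting and Assumption $(\Omega)$ described in the context. Let $vw$ be an edge of $T$. If $c(T[vw; w]) \geq k - g$, then there exists $(S, l, M, n) \in \mathcal{Q}$ with $v \in M \cup \{n\}$.
   Context: $\mathbb{N} = \{1,2,\dots\}$. $T$ is a finite tree with vertex weights $c : V(T) \to \mathbb{N}$; for a subgraph $H$, $c(H) := \sum_{v \in V(H)} c(v)$. $k, g \in \mathbb{N}$ with $1 \leq k \leq N_2 := c(T)$ and $c(v) \leq k$ for all $v \in V(T)$. For an edge $vw$ of $T$, $T[vw; w]$ is the component of $T - vw$ containing $w$. Euler tour: fix a planar embedding of $T$. For each $v$, list the incident edges in clockwise order as $e_{v,1},\dots,e_{v,d_T(v)}$. The directed cycle $C_T$ has vertices $w_{v,i}$ ($v \in V(T)$, $1 \le i \le d_T(v)$), indices taken modulo $d_T(v)$, and for every edge $uv = e_{u,i} = e_{v,j}$ of $T$ it has the arcs $w_{u,i} \to w_{v,j+1}$ and $w_{v,j} \to w_{u,i+1}$; $C_T$ is a directed cycle of length $2(|V(T)|-1)$. For $x$ on $C_T$, $x^+$ and $x^-$ denote its successor and predecessor; $[x,y]$ is the directed path from $x$ to $y$ along $C_T$. Let $\rho(w_{v,i}) := v$, $\rho([x,y])$ the subtree of $T$ induced by $\{\rho(z): z \in V([x,y])\}$, $c(z) := c(\rho(z))$ and $c([x,y]) := c(\rho([x,y]))$. Assumption $(\Omega)$: there are no $x, y \in V(C_T)$ with $k - g + 1 \leq c([x,y]) \leq k$. Overload-discharge quadruples: if $u, v \in V(C_T)$ satisfy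 $c([u, v^-]) < k - g + 1$ and $c([u,v]) > k$, let $w$ be the vertex of $[u, v^-]$ with $c([w,v]) > k$ and $c([w^+, v]) < k - g + 1$; the quadruple associated with $u,v$ is $Q_{u,v} := (\rho([u,v]), \rho(v), V(\rho([u,v])) \setminus V(\rho([w,v])), \rho(w))$. It is maximal if in addition $c([u^-, v^-]) > k$. $\mathcal{Q}$ is the set of all maximal quadruples $Q_{u,v}$, written as $(S,l,M,n)$. -}

module Defs where

open import Data.Nat using (ℕ; zero; suc; _+_; _*_; _∸_; _≤_; _<_)
import Data.Nat as ℕ
open import Data.Fin using (Fin)
import Data.Fin as F
open import Data.Bool using (Bool; true; false; if_then_else_)
open import Data.List using (List; []; _∷_; length; map; allFin)
open import Data.Nat.ListAction using (sum)
open import Data.List.Membership.Propositional using (_∈_)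
open import Data.List.Relation.Unary.Unique.Propositional using (Unique)
open import Data.Product using (Σ; ∃; _×_; _,_; proj₁; proj₂)
open import Data.Product.Properties using (≡-dec)
open import Data.Sum using (_⊎_)
open import Relation.Nullary using (¬_)
open import Relation.Nullary.Decidable using (⌊_⌋)
open import Relation.Binary.PropositionalEquality using (_≡_; _≢_)
open import Data.Unit using (⊤)

-- A finite tree with a planar embedding, given as a rotation system on
-- the vertex set Fin n:  rot v  lists the neighbours of v in clockwise
-- order, i.e. the i-th entry (0-based) of rot v is the other end of e_{v,i+1}.

RotSys : ℕ → Set
RotSys n = Fin n → List (Fin n)

module _ {n : ℕ} (rot : RotSys n) where

  deg : Fin n → ℕ
  deg v = length (rot v)

  data Reach (P : Fin n → Fin n → Set) : Fin n → Fin n → Set where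
    here : ∀ {a} → Reach P a a
    step : ∀ {a b d} → b ∈ rot a → P a b → Reach P b d → Reach P a d

  -- rot describes a (simple, undirected) tree: no loops, no multiple
  -- edges, symmetric adjacency, connected, and |E| = |V| - 1 (with |V| ≥ 1),
  -- expressed as  (sum of degrees) + 2 = 2|V|.
  record IsTree : Set where
    field
      noLoop    : ∀ v → ¬ (v ∈ rot v)
      noMulti   : ∀ v → Unique (rot v)
      symmetric : ∀ u v → v ∈ rot u → u ∈ rot v
      connected : ∀ u v → Reach (λ _ _ → ⊤) u v
      edgeCount : sum (map deg (allFin n)) + 2 ≡ 2 * n

  AvoidEdge : Fin n → Fin n → Fin n → Fin n → Set
  AvoidEdge v w a b = ¬ (a ≡ v × b ≡ w) × ¬ (a ≡ w × b ≡ v)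

  -- vertex set of T[vw; w] (the component of T - vw containing w)
  InComponent : Fin n → Fin n → Fin n → Set
  InComponent v w u = Reach (AvoidEdge v w) w u

-- The Euler tour C_T.  The vertex w_{v,i} (1 ≤ i ≤ d(v)) is represented
-- by the pair (v , i - 1) ; a pair (v , j) is a vertex of C_T iff j < d(v).

CV : ℕ → Set
CV n = Fin n × ℕ

_≟CV_ : ∀ {n} (x y : CV n) → Relation.Nullary.Dec (x ≡ y)
_≟CV_ = ≡-dec F._≟_ ℕ._≟_
  where import Relation.Nullary

at : ∀ {n} → Fin n → List (Fin n) → ℕ → Fin n
at d []       _       = d
at d (x ∷ xs) zero    = x
at d (x ∷ xs) (suc i) = at d xs i

-- 0-based position of a in the list (length of the list if absent)
indexOf : ∀ {n} → Fin n → List (Fin n) → ℕ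
indexOf a []       = zero
indexOf a (x ∷ xs) = if ⌊ a F.≟ x ⌋ then zero else suc (indexOf a xs)

nextIdx : ℕ → ℕ → ℕ
nextIdx d j = if ⌊ suc j ℕ.≟ d ⌋ then zero else suc j

prevIdx : ℕ → ℕ → ℕ
prevIdx d zero    = d ∸ 1
prevIdx d (suc j) = j

memB : ∀ {n} → Fin n → List (Fin n) → Bool
memB a []       = false
memB a (x ∷ xs) = if ⌊ a F.≟ x ⌋ then true else memB a xs

module _ {n : ℕ} (rot : RotSys n) where

  ValidCV : CV n → Set
  ValidCV (v , i) = i < deg rot v

  -- x ↦ x⁺ : for uv = e_{u,i} = e_{v,j}, the arc w_{u,i} → w_{v,j+1}
  succCV : CV n → CV n
  succCV (u , i) = let v = at u (rot u) i in
                   (v , nextIdx (deg rot v) (indexOf u (rot v)))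

  -- x ↦ x⁻ (inverse of succCV)
  predCV : CV n → CV n
  predCV (v , j) = let u = at v (rot v) (prevIdx (deg rot v) j) in
                   (u , indexOf v (rot u))

  cycleLen : ℕ
  cycleLen = 2 * (n ∸ 1)

  walk : ℕ → CV n → CV n → List (CV n)
  walk zero    x y = x ∷ []
  walk (suc f) x y = if ⌊ x ≟CV y ⌋ then x ∷ [] else x ∷ walk f (succCV x) y

  seg : CV n → CV n → List (CV n)
  seg x y = walk cycleLen x y

  inρ : CV n → CV n → Fin n → Bool
  inρ x y a = memB a (map proj₁ (seg x y))

wt : ∀ {n} → (Fin n → ℕ) → (Fin n → Bool) → ℕ
wt {n} c P = sum (map (λ v → if P v then c v else zero) (allFin n))

module _ {n : ℕ} (rot : RotSys n) (c : Fin n → ℕ) where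

  cseg : CV n → CV n → ℕ
  cseg x y = wt c (inρ rot x y)

  -- Assumption (Ω): no x,y ∈ V(C_T) with k - g + 1 ≤ c([x,y]) ≤ k
  -- (k - g + 1 ≤ c  is written  k + 1 ≤ c + g  to avoid truncated subtraction)
  Omega : ℕ → ℕ → Set
  Omega k g = ∀ x y → ValidCV rot x → ValidCV rot y →
              ¬ (k + 1 ≤ cseg x y + g × cseg x y ≤ k)

  -- u, v ∈ V(C_T) define a maximal quadruple Q_{u,v}, and w is the vertex of
  -- [u, v⁻] with c([w,v]) > k and c([w⁺,v]) < k - g + 1.
  -- (c < k - g + 1 is written c + g ≤ k.)
  record MaxQuadData (k g : ℕ) (u v w : CV n) : Set where
    field
      u-valid  : ValidCV rot u
      v-valid  : ValidCV rot v
      short    : cseg u (predCV rot v) + g ≤ k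
      overload : k < cseg u v
      maximal  : k < cseg (predCV rot u) (predCV rot v)
      w-on     : w ∈ seg rot u (predCV rot v)
      w-over   : k < cseg w v
      w-under  : cseg (succCV rot w) v + g ≤ k

  Q-S : CV n → CV n → Fin n → Bool
  Q-S u v = inρ rot u v

  Q-l : CV n → CV n → Fin n
  Q-l u v = proj₁ v

  Q-M : CV n → CV n → CV n → Fin n → Set
  Q-M u v w a = inρ rot u v a ≡ true × inρ rot w v a ≡ false

  Q-n : CV n → Fin n
  Q-n w = proj₁ w

  CoveredByMaxQuad : ℕ → ℕ → Fin n → Set
  CoveredByMaxQuad k g a =
    Σ (CV n) λ u → Σ (CV n) λ v → Σ (CV n) λ w →
      MaxQuadData k g u v w × (Q-M u v w a ⊎ a ≡ Q-n w)

module Submission where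

-- Follow C_T from the dart a = w_{v,i} with e_{v,i} = vw: it runs through all of T[vw; w]
-- before it first returns to v.  So some window [a, x] covers T[vw; w] and v; it weighs
-- at least c(T[vw; w]) + 1 ≥ k - g + 1 and hence, by (Ω), more than k.  The shortest
-- overloaded window [a, y] thus ends inside T[vw; w], and by (Ω) again [a, y⁻] is lighter
-- than k - g + 1.  Let z be the start of the last overloaded window ending at y, and extend
-- [·, y⁻] backwards from a until it overloads at u⁻; then Q_{u,y} is a maximal quadruple
-- with discharge vertex ρ(z).  Either z = a, so v = ρ(z), or z lies strictly between a and y,
-- so [z, y] stays inside T[vw; w] and v ∈ ρ([u, y]) \ ρ([z, y]).

open import Defs
open import Data.Nat using (ℕ; zero; suc; _+_; _*_; _∸_; _≤_; _<_; z≤n; s≤s)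
import Data.Nat as ℕ
open import Data.Nat.Properties
open import Data.Fin using (Fin; toℕ)
import Data.Fin as F
import Data.Fin.Properties as FP
open import Data.Bool using (Bool; true; false; T; if_then_else_; _∨_; _∧_)
open import Data.Bool.Properties using (T-∨; T-∧; ¬-not)
open import Data.List using (List; []; _∷_; length; map; allFin; lookup; _++_; upTo)
open import Data.Bool.ListAction using (any)
open import Data.Nat.ListAction using (sum)
open import Data.Nat.DivMod using (_%_; _/_; m≡m%n+[m/n]*n; m%n<n)
open import Data.List.Membership.Propositional using (_∈_; find)
open import Data.List.Membership.Propositional.Properties
  using (∈-map⁻; ∈-map⁺; ∈-++⁺ˡ; ∈-++⁺ʳ; ∈-upTo⁺; ∈-allFin; ∈-lookup)
open import Data.List.Membership.Setoid.Properties using (index-injective)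
open import Data.List.Properties using (length-++; length-map; length-upTo)
open import Data.List.Relation.Unary.Any using (here; there)
import Data.List.Relation.Unary.Any as Any
open import Data.List.Relation.Unary.Any.Properties using (any⁺; any⁻)
open import Data.List.Relation.Unary.All using (All; []; _∷_)
import Data.List.Relation.Unary.All as All
open import Data.List.Relation.Unary.Unique.Propositional using (Unique)
open import Data.List.Relation.Unary.Unique.Propositional.Properties using (allFin⁺)
open import Data.List.Relation.Unary.AllPairs using ([]; _∷_)
open import Data.Product using (Σ; ∃; _×_; _,_; proj₁; proj₂)
open import Data.Sum using (_⊎_; inj₁; inj₂; [_,_]′)
open import Data.Empty using (⊥; ⊥-elim)
open import Data.Unit using (⊤)
open import Function using (_∘_)
open import Function.Bundles using (_⇔_; Equivalence)
open import Function.Definitions using (Injective)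
open import Relation.Nullary using (¬_; Dec; yes; no; contradiction)
open import Relation.Nullary.Decidable using (⌊_⌋; _×-dec_; toWitness; fromWitness; T?)
open import Relation.Unary using (Decidable)
open import Relation.Binary.PropositionalEquality
open import Relation.Binary.Definitions using (tri<; tri≈; tri>)

lookup-injective : ∀ {A : Set} {xs : List A} → Unique xs →
                   ∀ {i j} → lookup xs i ≡ lookup xs j → i ≡ j
lookup-injective {xs = _ ∷ _} _        {F.zero}  {F.zero}  _  = refl
lookup-injective {xs = _ ∷ _} (x∉ ∷ _) {F.zero}  {F.suc j} eq = ⊥-elim (All.lookup x∉ (∈-lookup j) eq)
lookup-injective {xs = _ ∷ _} (x∉ ∷ _) {F.suc i} {F.zero}  eq = ⊥-elim (All.lookup x∉ (∈-lookup i) (sym eq))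
lookup-injective {xs = _ ∷ _} (_ ∷ u)  {F.suc i} {F.suc j} eq = cong F.suc (lookup-injective u eq)

injection⇒≤length : ∀ {A : Set} {m} {ys : List A} (f : Fin m → A) →
                    Injective _≡_ _≡_ f → (∀ i → f i ∈ ys) → m ≤ length ys
injection⇒≤length f f-inj f∈ys =
  FP.injective⇒≤ (λ eq → f-inj (index-injective (setoid _) (f∈ys _) (f∈ys _) eq))

Unique⇒length≤ : ∀ {n} {xs : List (Fin n)} → Unique xs → length xs ≤ n
Unique⇒length≤ u = FP.injective⇒≤ (lookup-injective u)

least : ∀ {P : ℕ → Set} → Decidable P → ∀ {m} → P m →
        Σ ℕ λ d → d ≤ m × P d × (∀ {d'} → d' < d → ¬ P d')
least {P} P? {m} Pm = [ (λ r → r) , (λ none → contradiction Pm (none ≤-refl)) ]′ (search m)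
  where
  search : ∀ m → (Σ ℕ λ d → d ≤ m × P d × (∀ {d'} → d' < d → ¬ P d')) ⊎ (∀ {d} → d ≤ m → ¬ P d)
  search zero with P? 0
  ... | yes P0 = inj₁ (0 , z≤n , P0 , λ ())
  ... | no ¬P0 = inj₂ λ { z≤n → ¬P0 }
  search (suc m) with search m | P? (suc m)
  ... | inj₁ (d , d≤m , Pd , min) | _ = inj₁ (d , m≤n⇒m≤1+n d≤m , Pd , min)
  ... | inj₂ none | yes P1+m = inj₁ (suc m , ≤-refl , P1+m , λ d<1+m → none (≤-pred d<1+m))
  ... | inj₂ none | no ¬P1+m = inj₂ λ d≤1+m →
        [ (λ d<1+m → none (≤-pred d<1+m)) , (λ { refl → ¬P1+m }) ]′ (m≤n⇒m<n∨m≡n d≤1+m)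

module _ {n : ℕ} where

  at-indexOf : ∀ d (a : Fin n) xs → a ∈ xs → at d xs (indexOf a xs) ≡ a
  at-indexOf d a (x ∷ xs) a∈ with a F.≟ x
  at-indexOf d a (x ∷ xs) a∈         | yes a≡x = sym a≡x
  at-indexOf d a (x ∷ xs) (here a≡x) | no a≢x  = contradiction a≡x a≢x
  at-indexOf d a (x ∷ xs) (there a∈) | no _    = at-indexOf d a xs a∈

  indexOf<length : ∀ (a : Fin n) xs → a ∈ xs → indexOf a xs < length xs
  indexOf<length a (x ∷ xs) a∈ with a F.≟ x
  indexOf<length a (x ∷ xs) a∈         | yes _   = s≤s z≤n
  indexOf<length a (x ∷ xs) (here a≡x) | no a≢x  = contradiction a≡x a≢x
  indexOf<length a (x ∷ xs) (there a∈) | no _    = s≤s (indexOf<length a xs a∈)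

  at∈ : ∀ (d : Fin n) xs {i} → i < length xs → at d xs i ∈ xs
  at∈ d (x ∷ xs) {zero}  _         = here refl
  at∈ d (x ∷ xs) {suc i} (s≤s i<) = there (at∈ d xs i<)

  at-irrelevant : ∀ (d d' : Fin n) xs {i} → i < length xs → at d xs i ≡ at d' xs i
  at-irrelevant d d' (x ∷ xs) {zero}  _         = refl
  at-irrelevant d d' (x ∷ xs) {suc i} (s≤s i<) = at-irrelevant d d' xs i<

  indexOf-at : ∀ (d : Fin n) xs {i} → Unique xs → i < length xs → indexOf (at d xs i) xs ≡ i
  indexOf-at d (x ∷ xs) {zero} _ _ with x F.≟ x
  ... | yes _   = refl
  ... | no x≢x  = contradiction refl x≢x
  indexOf-at d (x ∷ xs) {suc i} (x∉ ∷ u) (s≤s i<) with at d xs i F.≟ x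
  ... | yes eq = contradiction (sym eq) (All.lookup x∉ (at∈ d xs i<))
  ... | no _   = cong suc (indexOf-at d xs u i<)

  indexOf-injective : ∀ {a b : Fin n} xs → a ∈ xs → b ∈ xs → indexOf a xs ≡ indexOf b xs → a ≡ b
  indexOf-injective {a} {b} xs a∈ b∈ eq = begin
    a                        ≡⟨ sym (at-indexOf a a xs a∈) ⟩
    at a xs (indexOf a xs)   ≡⟨ cong (at a xs) eq ⟩
    at a xs (indexOf b xs)   ≡⟨ at-irrelevant a b xs (indexOf<length b xs b∈) ⟩
    at b xs (indexOf b xs)   ≡⟨ at-indexOf b b xs b∈ ⟩
    b                        ∎
    where open ≡-Reasoning

  memB⇒∈ : ∀ (a : Fin n) xs → memB a xs ≡ true → a ∈ xs
  memB⇒∈ a (x ∷ xs) h with a F.≟ x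
  ... | yes a≡x = here a≡x
  ... | no _    = there (memB⇒∈ a xs h)

  ∈⇒memB : ∀ (a : Fin n) xs → a ∈ xs → memB a xs ≡ true
  ∈⇒memB a (x ∷ xs) a∈ with a F.≟ x
  ∈⇒memB a (x ∷ xs) a∈         | yes _   = refl
  ∈⇒memB a (x ∷ xs) (here a≡x) | no a≢x  = contradiction a≡x a≢x
  ∈⇒memB a (x ∷ xs) (there a∈) | no _    = ∈⇒memB a xs a∈

nextIdx< : ∀ d {j} → j < d → nextIdx d j < d
nextIdx< d {j} j<d with suc j ℕ.≟ d
... | yes _    = ≤-trans (s≤s z≤n) j<d
... | no 1+j≢d = ≤∧≢⇒< j<d 1+j≢d

prevIdx-nextIdx : ∀ d j → prevIdx d (nextIdx d j) ≡ j
prevIdx-nextIdx d j with suc j ℕ.≟ d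
... | yes refl = refl
... | no _     = refl

nextIdx-last : ∀ d j → suc j ≡ d → nextIdx d j ≡ 0
nextIdx-last d j 1+j≡d with suc j ℕ.≟ d
... | yes _    = refl
... | no 1+j≢d = contradiction 1+j≡d 1+j≢d

nextIdx-notLast : ∀ d j → suc j ≢ d → nextIdx d j ≡ suc j
nextIdx-notLast d j 1+j≢d with suc j ℕ.≟ d
... | yes 1+j≡d = contradiction 1+j≡d 1+j≢d
... | no _      = refl

module Shift (d j : ℕ) (j<d : j < d) where

  shift : ℕ → ℕ
  shift zero    = j
  shift (suc q) = nextIdx d (shift q)

  shift< : ∀ q → shift q < d
  shift< zero    = j<d
  shift< (suc q) = nextIdx< d (shift< q)

  -- shift q is  j + q  reduced modulo d
  shift-spec : ∀ q → q ≤ d → (j + q < d → shift q ≡ j + q) × (d ≤ j + q → shift q + d ≡ j + q)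
  shift-spec zero _ = (λ _ → sym (+-identityʳ j)) ,
                      (λ d≤j+0 → contradiction (≤-trans d≤j+0 (≤-reflexive (+-identityʳ j))) (<⇒≱ j<d))
  shift-spec (suc q) 1+q≤d = below , above
    where
    ih = shift-spec q (≤-trans (n≤1+n q) 1+q≤d)
    below : j + suc q < d → shift (suc q) ≡ j + suc q
    below j+1+q<d = begin
      nextIdx d (shift q)   ≡⟨ cong (nextIdx d) (proj₁ ih (≤-trans (n≤1+n _) 1+j+q<d)) ⟩
      nextIdx d (j + q)     ≡⟨ nextIdx-notLast d (j + q) (λ eq → <-irrefl eq 1+j+q<d) ⟩
      suc (j + q)           ≡⟨ sym (+-suc j q) ⟩
      j + suc q             ∎
      where open ≡-Reasoning
            1+j+q<d = subst (_< d) (+-suc j q) j+1+q<d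
    above : d ≤ j + suc q → shift (suc q) + d ≡ j + suc q
    above d≤ with j + q <? d
    ... | yes j+q<d = begin
      nextIdx d (shift q) + d   ≡⟨ cong (λ s → nextIdx d s + d) (proj₁ ih j+q<d) ⟩
      nextIdx d (j + q) + d     ≡⟨ cong (_+ d) (nextIdx-last d (j + q) 1+j+q≡d) ⟩
      d                         ≡⟨ sym 1+j+q≡d ⟩
      suc (j + q)               ≡⟨ sym (+-suc j q) ⟩
      j + suc q                 ∎
      where open ≡-Reasoning
            1+j+q≡d = ≤-antisym j+q<d (subst (d ≤_) (+-suc j q) d≤)
    ... | no j+q≮d with suc (shift q) ℕ.≟ d
    ...   | no _ = begin
      suc (shift q + d)         ≡⟨ cong suc (proj₂ ih (≮⇒≥ j+q≮d)) ⟩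
      suc (j + q)               ≡⟨ sym (+-suc j q) ⟩
      j + suc q                 ∎
      where open ≡-Reasoning
    -- shift q = d - 1 would force j + q = 2d - 1, although j < d and q < d
    ...   | yes 1+s≡d = contradiction (sym (trans (cong (shift q +_) 1+s≡d) (proj₂ ih (≮⇒≥ j+q≮d))))
                          (<⇒≢ (+-mono-≤-< j≤s q<1+s))
      where
      j≤s : j ≤ shift q
      j≤s = ≤-pred (subst (j <_) (sym 1+s≡d) j<d)
      q<1+s : q < suc (shift q)
      q<1+s = subst (q <_) (sym 1+s≡d) 1+q≤d

  shift-full : shift d ≡ j
  shift-full = +-cancelʳ-≡ d (shift d) j (proj₂ (shift-spec d ≤-refl) (m≤n+m d j))

  shift-≢ : ∀ {q} → 1 ≤ q → q < d → shift q ≢ j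
  shift-≢ {q} 1≤q q<d eq with j + q <? d
  ... | yes j+q<d = <-irrefl (trans (sym eq) (proj₁ (shift-spec q (<⇒≤ q<d)) j+q<d)) (m<m+n j 1≤q)
  ... | no j+q≮d  = <-irrefl
    (sym (trans (cong (_+ d) (sym eq)) (proj₂ (shift-spec q (<⇒≤ q<d)) (≮⇒≥ j+q≮d))))
    (+-monoʳ-< j q<d)

  shift-onto : ∀ {m} → m < d → m ≢ j → Σ ℕ λ q → 1 ≤ q × q < d × shift q ≡ m
  shift-onto {m} m<d m≢j with <-cmp m j
  ... | tri≈ _ m≡j _ = contradiction m≡j m≢j
  ... | tri> _ _ j<m = m ∸ j , m<n⇒0<n∸m j<m , ≤-<-trans (m∸n≤m m j) m<d ,
                       trans (proj₁ (shift-spec (m ∸ j) (≤-trans (m∸n≤m m j) (<⇒≤ m<d))) j+q<d) j+q≡m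
    where
    j+q≡m : j + (m ∸ j) ≡ m
    j+q≡m = m+[n∸m]≡n (<⇒≤ j<m)
    j+q<d : j + (m ∸ j) < d
    j+q<d = subst (_< d) (sym j+q≡m) m<d
  ... | tri< m<j _ _ = q , 1≤q , q<d , +-cancelʳ-≡ d (shift q) m (trans
                         (proj₂ (shift-spec q (<⇒≤ q<d)) (subst (d ≤_) (sym j+q≡m+d) (m≤n+m d m)))
                         j+q≡m+d)
    where
    q = m + (d ∸ j)
    j+q≡m+d : j + q ≡ m + d
    j+q≡m+d = begin
      j + (m + (d ∸ j))   ≡⟨ +-assoc j m (d ∸ j) ⟨
      j + m + (d ∸ j)     ≡⟨ cong (_+ (d ∸ j)) (+-comm j m) ⟩
      m + j + (d ∸ j)     ≡⟨ +-assoc m j (d ∸ j) ⟩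
      m + (j + (d ∸ j))   ≡⟨ cong (m +_) (m+[n∸m]≡n (<⇒≤ j<d)) ⟩
      m + d               ∎
      where open ≡-Reasoning
    1≤q : 1 ≤ q
    1≤q = ≤-trans (m<n⇒0<n∸m j<d) (m≤n+m (d ∸ j) m)
    q<d : q < d
    q<d = +-cancelˡ-< j q d (subst (_< j + d) (sym j+q≡m+d) (+-monoˡ-< d m<j))

range : ℕ → ℕ → List ℕ
range i zero    = i ∷ []
range i (suc d) = i ∷ range (suc i) d

∈-range⁻ : ∀ {i d e} → e ∈ range i d → i ≤ e × e ≤ d + i
∈-range⁻ {d = zero}  (here refl) = ≤-refl , ≤-refl
∈-range⁻ {i} {suc d} (here refl) = ≤-refl , m≤n+m i (suc d)
∈-range⁻ {i} {suc d} {e} (there e∈) =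
  let (i<e , e≤) = ∈-range⁻ e∈ in <⇒≤ i<e , subst (e ≤_) (+-suc d i) e≤

∈-range⁺ : ∀ {i d e} → i ≤ e → e ≤ d + i → e ∈ range i d
∈-range⁺ {d = zero}  i≤e e≤ = here (≤-antisym e≤ i≤e)
∈-range⁺ {i} {suc d} {e} i≤e e≤ with m≤n⇒m<n∨m≡n i≤e
... | inj₂ refl = here refl
... | inj₁ i<e  = there (∈-range⁺ i<e (subst (e ≤_) (sym (+-suc d i)) e≤))

module Tree {n : ℕ} (rot : RotSys n) (tree : IsTree rot) where
  open IsTree tree

  _⁺ : CV n → CV n
  x ⁺ = succCV rot x

  succ-valid : ∀ {x} → ValidCV rot x → ValidCV rot (x ⁺)
  succ-valid {u , i} i<deg = nextIdx< _ (indexOf<length u (rot (at u (rot u) i))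
                               (symmetric u _ (at∈ u (rot u) i<deg)))

  pred-succ : ∀ {x} → ValidCV rot x → predCV rot (x ⁺) ≡ x
  pred-succ {u , i} i<deg = begin
    (at v (rot v) (prevIdx (deg rot v) (nextIdx (deg rot v) j)) , _)
      ≡⟨ cong (λ q → at v (rot v) q , indexOf v (rot (at v (rot v) q))) (prevIdx-nextIdx (deg rot v) j) ⟩
    (at v (rot v) j , indexOf v (rot (at v (rot v) j)))
      ≡⟨ cong (λ q → q , indexOf v (rot q)) (at-indexOf v u (rot v) u∈) ⟩
    (u , indexOf v (rot u))
      ≡⟨ cong (u ,_) (indexOf-at u (rot u) (noMulti u) i<deg) ⟩
    (u , i) ∎
    where
    open ≡-Reasoning
    v = at u (rot u) i
    u∈ = symmetric u v (at∈ u (rot u) i<deg)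
    j = indexOf u (rot v)

  succ-injective : ∀ {x y} → ValidCV rot x → ValidCV rot y → x ⁺ ≡ y ⁺ → x ≡ y
  succ-injective {x} {y} x-valid y-valid eq =
    trans (sym (pred-succ x-valid)) (trans (cong (predCV rot) eq) (pred-succ y-valid))

  _⁺^_ : CV n → ℕ → CV n
  x ⁺^ zero  = x
  x ⁺^ suc e = (x ⁺^ e) ⁺

  ⁺^-+ : ∀ x e₁ e₂ → x ⁺^ (e₁ + e₂) ≡ (x ⁺^ e₂) ⁺^ e₁
  ⁺^-+ x zero     e₂ = refl
  ⁺^-+ x (suc e₁) e₂ = cong _⁺ (⁺^-+ x e₁ e₂)

  ⁺^-suc : ∀ x e → (x ⁺) ⁺^ e ≡ (x ⁺^ e) ⁺
  ⁺^-suc x zero    = refl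
  ⁺^-suc x (suc e) = cong _⁺ (⁺^-suc x e)

  ⁺^-valid : ∀ {x} e → ValidCV rot x → ValidCV rot (x ⁺^ e)
  ⁺^-valid zero    x-valid = x-valid
  ⁺^-valid (suc e) x-valid = succ-valid (⁺^-valid e x-valid)

  dart : Fin n → Fin n → CV n
  dart a b = (a , indexOf b (rot a))

  dart-valid : ∀ {a b} → b ∈ rot a → ValidCV rot (dart a b)
  dart-valid {a} {b} b∈ = indexOf<length b (rot a) b∈

  dart-injective : ∀ {a b a' b'} → b ∈ rot a → b' ∈ rot a' → dart a b ≡ dart a' b' → a ≡ a' × b ≡ b'
  dart-injective b∈ b'∈ eq with cong proj₁ eq
  ... | refl = refl , indexOf-injective (rot _) b∈ b'∈ (cong proj₂ eq)

  succ-dart : ∀ {a b} → b ∈ rot a → dart a b ⁺ ≡ (b , nextIdx (deg rot b) (indexOf a (rot b)))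
  succ-dart {a} {b} b∈ =
    cong (λ q → q , nextIdx (deg rot q) (indexOf a (rot q))) (at-indexOf a b (rot a) b∈)

  darts : List (Fin n) → List (CV n)
  darts []       = []
  darts (v ∷ vs) = map (v ,_) (upTo (deg rot v)) ++ darts vs

  length-darts : ∀ vs → length (darts vs) ≡ sum (map (deg rot) vs)
  length-darts []       = refl
  length-darts (v ∷ vs) = trans (length-++ (map (v ,_) (upTo (deg rot v))))
    (cong₂ _+_ (trans (length-map _ (upTo (deg rot v))) (length-upTo _)) (length-darts vs))

  ∈-darts : ∀ {vs v i} → v ∈ vs → i < deg rot v → (v , i) ∈ darts vs
  ∈-darts {v ∷ _} (here refl) i<deg = ∈-++⁺ˡ (∈-map⁺ (_ ,_) (∈-upTo⁺ i<deg))
  ∈-darts {u ∷ _} (there v∈) i<deg = ∈-++⁺ʳ _ (∈-darts v∈ i<deg)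

  -- C_T has only 2(n - 1) darts, by the handshake lemma  IsTree.edgeCount.
  injection⇒≤darts : ∀ {m} (f : Fin m → CV n) → Injective _≡_ _≡_ f →
                     (∀ i → ValidCV rot (f i)) → m + 2 ≤ 2 * n
  injection⇒≤darts {m} f f-inj f-valid = begin
    m + 2                                  ≤⟨ +-monoˡ-≤ 2 (injection⇒≤length f f-inj
                                                (λ i → ∈-darts (∈-allFin _) (f-valid i))) ⟩
    length (darts (allFin n)) + 2          ≡⟨ cong (_+ 2) (length-darts (allFin n)) ⟩
    sum (map (deg rot) (allFin n)) + 2     ≡⟨ edgeCount ⟩
    2 * n                                  ∎
    where open ≤-Reasoning

  snoc : ∀ {P a b d} → Reach rot P a b → d ∈ rot b → P b d → Reach rot P a d
  snoc here           d∈ Pbd = step d∈ Pbd here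
  snoc (step b∈ p r) d∈ Pbd = step b∈ p (snoc r d∈ Pbd)

  _++ᴿ_ : ∀ {P a b d} → Reach rot P a b → Reach rot P b d → Reach rot P a d
  here          ++ᴿ r' = r'
  step b∈ p r ++ᴿ r' = step b∈ p (r ++ᴿ r')

  reverseᴿ : ∀ {P a b} → (∀ {x y} → P x y → P y x) → Reach rot P a b → Reach rot P b a
  reverseᴿ P-sym here                      = here
  reverseᴿ P-sym (step {a} {b} b∈ p r) = snoc (reverseᴿ P-sym r) (symmetric a b b∈) (P-sym p)

  avoid-sym : ∀ {v w x y} → AvoidEdge rot v w x y → AvoidEdge rot v w y x
  avoid-sym (¬vw , ¬wv) = (λ { (e₁ , e₂) → ¬wv (e₂ , e₁) }) , (λ { (e₁ , e₂) → ¬vw (e₂ , e₁) })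

  avoid-swap : ∀ {v w x y} → AvoidEdge rot v w x y → AvoidEdge rot w v x y
  avoid-swap (¬vw , ¬wv) = ¬wv , ¬vw

  avoid? : ∀ v w x y → AvoidEdge rot v w x y ⊎ ((x ≡ v × y ≡ w) ⊎ (x ≡ w × y ≡ v))
  avoid? v w x y with x F.≟ v ×-dec y F.≟ w | x F.≟ w ×-dec y F.≟ v
  ... | yes e  | _      = inj₂ (inj₁ e)
  ... | no _   | yes e  = inj₂ (inj₂ e)
  ... | no ¬e  | no ¬e' = inj₁ (¬e , ¬e')

  -- If x could return to w avoiding the edge wx, then T - wx would be connected; a
  -- breadth-first search from w in T - wx gives every y ≢ w a parent edge, and these
  -- together with wx are n distinct edges, i.e. 2n darts, while a tree has 2(n - 1).
  module ReturnWalk (w x : Fin n) (x∈ : x ∈ rot w) (back : Reach rot (AvoidEdge rot w x) x w) where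
    Av : Fin n → Fin n → Set
    Av = AvoidEdge rot w x

    avoid-everywhere : ∀ {a y} → Reach rot (λ _ _ → ⊤) a y → Reach rot Av a y
    avoid-everywhere here = here
    avoid-everywhere (step {a} {b} b∈ _ r) with avoid? w x a b
    ... | inj₁ av                   = step b∈ av (avoid-everywhere r)
    ... | inj₂ (inj₁ (refl , refl)) = reverseᴿ avoid-sym back ++ᴿ avoid-everywhere r
    ... | inj₂ (inj₂ (refl , refl)) = back ++ᴿ avoid-everywhere r

    avoids? : ∀ a y → Dec (Av a y)
    avoids? a y with avoid? w x a y
    ... | inj₁ av         = yes av
    ... | inj₂ (inj₁ e) = no (λ av → proj₁ av e)
    ... | inj₂ (inj₂ e) = no (λ av → proj₂ av e)

    reached : ℕ → Fin n → Bool
    reached zero    y = ⌊ y F.≟ w ⌋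
    reached (suc m) y = reached m y ∨ any (λ a → reached m a ∧ ⌊ avoids? a y ⌋) (rot y)

    reached-step : ∀ {m a y} → T (reached m a) → a ∈ rot y → Av a y → T (reached (suc m) y)
    reached-step {m} {y = y} r a∈ av = Equivalence.from T-∨ (inj₂
      (any⁺ (λ a → reached m a ∧ ⌊ avoids? a y ⌋)
            (Any.map (λ { refl → Equivalence.from T-∧ (r , fromWitness av) }) a∈)))

    reached-suc⁻ : ∀ {m y} → T (reached (suc m) y) →
                   T (reached m y) ⊎ Σ (Fin n) λ a → a ∈ rot y × T (reached m a) × Av a y
    reached-suc⁻ {m} {y} r with Equivalence.to T-∨ r
    ... | inj₁ r' = inj₁ r'
    ... | inj₂ r' with find (any⁻ (λ a → reached m a ∧ ⌊ avoids? a y ⌋) (rot y) r')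
    ...   | a , a∈ , ra = let (ra' , av) = Equivalence.to T-∧ ra in inj₂ (a , a∈ , ra' , toWitness av)

    reached-along : ∀ {m a y} → T (reached m a) → Reach rot Av a y → ∃ λ m' → T (reached m' y)
    reached-along {m} r here                      = m , r
    reached-along {m} r (step {a} {b} b∈ av rest) =
      reached-along {suc m} (reached-step {m} r (symmetric a b b∈) av) rest

    opaque
      shortest : ∀ y → Σ ℕ λ d → T (reached d y) × (∀ {d'} → d' < d → ¬ T (reached d' y))
      shortest y =
        let (m , r)            = reached-along {0} (fromWitness refl) (avoid-everywhere (connected w y))
            (d , _ , rd , min) = least (λ m → T? (reached m y)) {m} r
        in d , rd , min

    level : Fin n → ℕ
    level y = proj₁ (shortest y)

    level-minimal : ∀ {m y} → T (reached m y) → level y ≤ m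
    level-minimal {m} {y} r with m <? level y
    ... | yes m< = contradiction r (proj₂ (proj₂ (shortest y)) m<)
    ... | no m≮  = ≮⇒≥ m≮

    record Parent (y : Fin n) : Set where
      field
        vertex   : Fin n
        adjacent : vertex ∈ rot y
        avoids   : Av vertex y
        closer   : level vertex < level y

    parent : ∀ y → y ≢ w → Parent y
    parent y y≢w with shortest y in eq
    ... | zero , r , _    = contradiction (toWitness r) y≢w
    ... | suc m , r , min with reached-suc⁻ {m} r
    ...   | inj₁ r'                 = contradiction r' (min ≤-refl)
    ...   | inj₂ (a , a∈ , ra , av) = record
      { vertex = a ; adjacent = a∈ ; avoids = av
      ; closer = subst (level a <_) (sym (cong proj₁ eq)) (s≤s (level-minimal {m} {a} ra)) }

    up : Fin n → Fin n
    up y with y F.≟ w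
    ... | yes _  = x
    ... | no y≢w = Parent.vertex (parent y y≢w)

    up∈ : ∀ y → up y ∈ rot y
    up∈ y with y F.≟ w
    ... | yes refl = x∈
    ... | no y≢w   = Parent.adjacent (parent y y≢w)

    no-2-cycle : ∀ y y' → up y ≡ y' → up y' ≡ y → ⊥
    no-2-cycle y y' with y F.≟ w | y' F.≟ w
    ... | yes refl | yes refl = λ x≡w _ → noLoop w (subst (_∈ rot w) x≡w x∈)
    ... | yes refl | no y'≢w  = λ { refl up≡w → proj₁ (Parent.avoids (parent x y'≢w)) (up≡w , refl) }
    ... | no y≢w   | yes refl = λ { up≡w refl → proj₁ (Parent.avoids (parent x y≢w)) (up≡w , refl) }
    ... | no y≢w   | no y'≢w  = λ up≡y' up'≡y → <-asym
          (subst (λ a → level a < level y) up≡y' (Parent.closer (parent y y≢w)))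
          (subst (λ a → level a < level y') up'≡y (Parent.closer (parent y' y'≢w)))

    up-edge : Fin n ⊎ Fin n → CV n
    up-edge (inj₁ y) = dart y (up y)
    up-edge (inj₂ y) = dart (up y) y

    up∋ : ∀ y → y ∈ rot (up y)
    up∋ y = symmetric y (up y) (up∈ y)

    up-edge-valid : ∀ i → ValidCV rot (up-edge i)
    up-edge-valid (inj₁ y) = dart-valid (up∈ y)
    up-edge-valid (inj₂ y) = dart-valid (up∋ y)

    up-edge-injective : Injective _≡_ _≡_ up-edge
    up-edge-injective {inj₁ y} {inj₁ y'} eq = cong inj₁ (proj₁ (dart-injective (up∈ y) (up∈ y') eq))
    up-edge-injective {inj₂ y} {inj₂ y'} eq = cong inj₂ (proj₂ (dart-injective (up∋ y) (up∋ y') eq))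
    up-edge-injective {inj₁ y} {inj₂ y'} eq =
      let (y≡up' , up≡y') = dart-injective (up∈ y) (up∋ y') eq
      in ⊥-elim (no-2-cycle y y' up≡y' (sym y≡up'))
    up-edge-injective {inj₂ y} {inj₁ y'} eq =
      let (up≡y' , y≡up') = dart-injective (up∋ y) (up∈ y') eq
      in ⊥-elim (no-2-cycle y y' up≡y' (sym y≡up'))

    splitAt-injective : Injective _≡_ _≡_ (F.splitAt n {n})
    splitAt-injective {i} {j} eq =
      trans (sym (FP.join-splitAt n n i)) (trans (cong (F.join n n) eq) (FP.join-splitAt n n j))

    impossible : ⊥
    impossible = <⇒≱ (m<m+n (n + n) (s≤s z≤n)) (subst (n + n + 2 ≤_) (cong (n +_) (+-identityʳ n))
      (injection⇒≤darts (up-edge ∘ F.splitAt n) (splitAt-injective ∘ up-edge-injective)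
                        (up-edge-valid ∘ F.splitAt n)))

  no-return : ∀ {w x} → x ∈ rot w → ¬ Reach rot (AvoidEdge rot w x) x w
  no-return x∈ back = ReturnWalk.impossible _ _ x∈ back

  w≢v : ∀ {v w} → w ∈ rot v → w ≢ v
  w≢v w∈ refl = noLoop _ w∈

  v∉component : ∀ {v w} → w ∈ rot v → ¬ InComponent rot v w v
  v∉component = no-return

  component-nested : ∀ {v w x y} → w ∈ rot v → x ∈ rot w → x ≢ v →
                     InComponent rot w x y → InComponent rot v w y
  component-nested {v} {w} {x} w∈ x∈ x≢v =
    extend here (step x∈ ((w≢v w∈ ∘ proj₁) , (x≢v ∘ proj₂)) here)
    where
    extend : ∀ {a y} → Reach rot (AvoidEdge rot w x) x a → Reach rot (AvoidEdge rot v w) w a →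
             Reach rot (AvoidEdge rot w x) a y → Reach rot (AvoidEdge rot v w) w y
    extend x→a w→a here = w→a
    extend {a} x→a w→a (step {b = b} b∈ av r) with avoid? v w a b
    ... | inj₁ av'                  = extend (snoc x→a b∈ av) (snoc w→a b∈ av') r
    ... | inj₂ (inj₁ (refl , refl)) = ⊥-elim (no-return x∈ (snoc x→a b∈ av))
    ... | inj₂ (inj₂ (refl , refl)) = ⊥-elim (no-return x∈ x→a)

  component-cover : ∀ v w y → InComponent rot v w y ⊎ InComponent rot w v y
  component-cover v w y = go (inj₁ here) (connected w y)
    where
    go : ∀ {a y} → InComponent rot v w a ⊎ InComponent rot w v a → Reach rot (λ _ _ → ⊤) a y →
         InComponent rot v w y ⊎ InComponent rot w v y
    go side here = side
    go {a} side (step {b = b} b∈ _ r) with avoid? v w a b | side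
    ... | inj₁ av | inj₁ w→a        = go (inj₁ (snoc w→a b∈ av)) r
    ... | inj₁ av | inj₂ v→a        = go (inj₂ (snoc v→a b∈ (avoid-swap av))) r
    ... | inj₂ (inj₁ (refl , refl)) | _ = go (inj₁ here) r
    ... | inj₂ (inj₂ (refl , refl)) | _ = go (inj₂ here) r

  BranchAt : Fin n → Fin n → Fin n → Set
  BranchAt v w y = y ≡ w ⊎ Σ (Fin n) λ x → x ∈ rot w × x ≢ v × InComponent rot w x y

  component-branch : ∀ {v w y} → InComponent rot v w y → BranchAt v w y
  component-branch {v} {w} = go (inj₁ refl)
    where
    go : ∀ {a y} → BranchAt v w a → Reach rot (AvoidEdge rot v w) a y → BranchAt v w y
    go branch here = branch
    go (inj₁ refl) (step {b = b} b∈ av r) = go (inj₂ (b , b∈ , (λ b≡v → proj₂ av (refl , b≡v)) , here)) r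
    go {a} (inj₂ (x , x∈ , x≢v , x→a)) (step {b = b} b∈ av r) with avoid? w x a b
    ... | inj₁ av'                  = go (inj₂ (x , x∈ , x≢v , snoc x→a b∈ av')) r
    ... | inj₂ (inj₁ (refl , refl)) = go (inj₂ (x , x∈ , x≢v , here)) r
    ... | inj₂ (inj₂ (refl , refl)) = go (inj₁ refl) r

  Stays : CV n → ℕ → (Fin n → Set) → Set
  Stays x L Q = ∀ {e} → e ≤ L → Q (proj₁ (x ⁺^ e))

  Visits : CV n → ℕ → Fin n → Set
  Visits x L y = Σ ℕ λ e → e ≤ L × proj₁ (x ⁺^ e) ≡ y

  ⁺^-concat : ∀ {x y z} L₁ L₂ → x ⁺^ L₁ ≡ y → (y ⁺) ⁺^ L₂ ≡ z → x ⁺^ (suc L₂ + L₁) ≡ z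
  ⁺^-concat {x} {y} L₁ L₂ x→y y⁺→z = begin
    x ⁺^ (suc L₂ + L₁)    ≡⟨ ⁺^-+ x (suc L₂) L₁ ⟩
    ((x ⁺^ L₁) ⁺^ L₂) ⁺   ≡⟨ cong (λ q → (q ⁺^ L₂) ⁺) x→y ⟩
    (y ⁺^ L₂) ⁺           ≡⟨ sym (⁺^-suc y L₂) ⟩
    (y ⁺) ⁺^ L₂           ≡⟨ y⁺→z ⟩
    _                     ∎
    where open ≡-Reasoning

  ≤-concat : ∀ {e} L₁ L₂ → e ≤ suc L₂ + L₁ → e ≤ L₁ ⊎ Σ ℕ λ e' → e' ≤ L₂ × e ≡ suc e' + L₁
  ≤-concat {e} L₁ L₂ e≤ with e ≤? L₁
  ... | yes e≤L₁ = inj₁ e≤L₁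
  ... | no e≰L₁  =
    inj₂ (e ∸ suc L₁ , subst (e ∸ suc L₁ ≤_) (m+n∸n≡m L₂ (suc L₁)) (∸-monoˡ-≤ (suc L₁) e≤') , eq)
    where
    L₁<e = ≰⇒> e≰L₁
    e≤' : e ≤ L₂ + suc L₁
    e≤' = subst (e ≤_) (sym (+-suc L₂ L₁)) e≤
    eq : e ≡ suc (e ∸ suc L₁) + L₁
    eq = trans (sym (m∸n+n≡m L₁<e)) (+-suc (e ∸ suc L₁) L₁)

  stays-concat : ∀ {Q x y} L₁ L₂ → x ⁺^ L₁ ≡ y → Stays x L₁ Q → Stays (y ⁺) L₂ Q →
                 Stays x (suc L₂ + L₁) Q
  stays-concat {Q} {x} L₁ L₂ x→y first second e≤ with ≤-concat L₁ L₂ e≤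
  ... | inj₁ e≤L₁              = first e≤L₁
  ... | inj₂ (e' , e'≤ , refl) = subst (Q ∘ proj₁) (sym (⁺^-concat L₁ e' x→y refl)) (second e'≤)

  visits-mono : ∀ {x L L' y} → L ≤ L' → Visits x L y → Visits x L' y
  visits-mono L≤L' (e , e≤ , eq) = e , ≤-trans e≤ L≤L' , eq

  visits-concat : ∀ {x y z} L₁ L₂ → x ⁺^ L₁ ≡ y → Visits (y ⁺) L₂ z → Visits x (suc L₂ + L₁) z
  visits-concat L₁ L₂ x→y (e , e≤ , eq) =
    suc e + L₁ , +-monoˡ-≤ L₁ (s≤s e≤) , trans (cong proj₁ (⁺^-concat L₁ e x→y refl)) eq

  enter : Fin n → Fin n → CV n
  enter v w = dart v w ⁺

  -- The stretch of C_T from w_{w,j+1} (just after the arc v → w) to w_{w,j} (where e_{w,j} = wv).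
  record Tour (v w : Fin n) : Set where
    field
      steps  : ℕ
      ends   : enter v w ⁺^ steps ≡ dart w v
      inside : Stays (enter v w) steps (InComponent rot v w)
      covers : ∀ {y} → InComponent rot v w y → Visits (enter v w) steps y

  module AroundVertex {v w : Fin n} (w∈ : w ∈ rot v)
                      (subtour : ∀ {x} → x ∈ rot w → x ≢ v → Tour w x) where
    d = deg rot w
    j = indexOf v (rot w)
    v∈ : v ∈ rot w
    v∈ = symmetric v w w∈
    j<d : j < d
    j<d = indexOf<length v (rot w) v∈
    open Shift d j j<d

    branch : ℕ → Fin n
    branch q = at w (rot w) (shift q)

    record Partial (r : ℕ) : Set where
      field
        steps  : ℕ
        ends   : enter v w ⁺^ steps ≡ (w , shift r)
        inside : Stays (enter v w) steps (InComponent rot v w)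
        covers : ∀ {y} → y ≡ w ⊎ (Σ ℕ λ q → 1 ≤ q × q < r × InComponent rot w (branch q) y) →
                 Visits (enter v w) steps y

    enter≡ : enter v w ≡ (w , shift 1)
    enter≡ = succ-dart w∈

    start : Partial 1
    start = record
      { steps  = 0
      ; ends   = enter≡
      ; inside = λ { z≤n → subst (InComponent rot v w ∘ proj₁) (sym enter≡) here }
      ; covers = λ { (inj₁ refl) → 0 , z≤n , cong proj₁ enter≡
                   ; (inj₂ (q , 1≤q , q<1 , _)) → contradiction (≤-trans 1≤q (≤-pred q<1)) λ () }
      }

    extend : ∀ {r} → 1 ≤ r → r < d → Partial r → Partial (suc r)
    extend {r} 1≤r r<d P = record
      { steps  = suc L
      ; ends   = ⁺^-concat L 0 reach-x out-of-x
      ; inside = stays-concat {InComponent rot v w} L 0 reach-x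
                   (stays-concat {InComponent rot v w} P.steps tour.steps P.ends P.inside
                     (subst (λ z → Stays z tour.steps (InComponent rot v w)) (sym into-x)
                       (component-nested w∈ x∈ x≢v ∘ tour.inside)))
                   (λ { z≤n → subst (InComponent rot v w ∘ proj₁) (sym out-of-x) here })
      ; covers = covers
      }
      where
      module P = Partial P
      x = branch r
      x∈ : x ∈ rot w
      x∈ = at∈ w (rot w) (shift< r)
      x∋w : w ∈ rot x
      x∋w = symmetric w x x∈
      indexOf-x : indexOf x (rot w) ≡ shift r
      indexOf-x = indexOf-at w (rot w) (noMulti w) (shift< r)
      x≢v : x ≢ v
      x≢v x≡v = shift-≢ 1≤r r<d (trans (sym indexOf-x) (cong (λ q → indexOf q (rot w)) x≡v))
      module tour = Tour (subtour x∈ x≢v)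
      into-x : (w , shift r) ⁺ ≡ enter w x
      into-x = cong (λ q → (w , q) ⁺) (sym indexOf-x)
      out-of-x : dart x w ⁺ ≡ (w , shift (suc r))
      out-of-x = trans (succ-dart x∋w) (cong (λ q → w , nextIdx d q) indexOf-x)
      L = suc tour.steps + P.steps
      reach-x : enter v w ⁺^ L ≡ dart x w
      reach-x = ⁺^-concat P.steps tour.steps P.ends
                  (subst (λ z → z ⁺^ tour.steps ≡ dart x w) (sym into-x) tour.ends)
      P≤L : P.steps ≤ suc L
      P≤L = ≤-trans (m≤n+m P.steps (suc tour.steps)) (n≤1+n L)
      covers : ∀ {y} → y ≡ w ⊎ (Σ ℕ λ q → 1 ≤ q × q < suc r × InComponent rot w (branch q) y) →
               Visits (enter v w) (suc L) y
      covers (inj₁ y≡w) = visits-mono P≤L (P.covers (inj₁ y≡w))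
      covers (inj₂ (q , 1≤q , q<1+r , y∈)) with m≤n⇒m<n∨m≡n (≤-pred q<1+r)
      ... | inj₁ q<r  = visits-mono P≤L (P.covers (inj₂ (q , 1≤q , q<r , y∈)))
      ... | inj₂ refl = visits-mono (n≤1+n L) (visits-concat P.steps tour.steps P.ends
                          (subst (λ z → Visits z tour.steps _) (sym into-x) (tour.covers y∈)))

    partial : ∀ r → r < d → Partial (suc r)
    partial zero    _     = start
    partial (suc r) 1+r<d = extend (s≤s z≤n) 1+r<d (partial r (<-trans (n<1+n r) 1+r<d))

    around : Tour v w
    around = record
      { steps  = Pd.steps
      ; ends   = trans Pd.ends (cong (w ,_) shift-full)
      ; inside = Pd.inside
      ; covers = covers
      }
      where
      1+[d-1]≡d : suc (d ∸ 1) ≡ d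
      1+[d-1]≡d = m+[n∸m]≡n {1} (≤-trans (s≤s z≤n) j<d)
      module Pd = Partial (subst Partial 1+[d-1]≡d (partial (d ∸ 1) (subst (d ∸ 1 <_) 1+[d-1]≡d ≤-refl)))
      covers : ∀ {y} → InComponent rot v w y → Visits (enter v w) Pd.steps y
      covers y∈ with component-branch y∈
      ... | inj₁ y≡w = Pd.covers (inj₁ y≡w)
      ... | inj₂ (x , x∈ , x≢v , y∈') =
        let (q , 1≤q , q<d , shift≡) = shift-onto (indexOf<length x (rot w) x∈)
                                         (x≢v ∘ indexOf-injective (rot w) x∈ v∈)
            branch≡x = trans (cong (at w (rot w)) shift≡) (at-indexOf w x (rot w) x∈)
        in Pd.covers (inj₂ (q , 1≤q , q<d , subst (λ z → InComponent rot w z _) (sym branch≡x) y∈'))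

  -- anc lists ancestors of v, all distinct and outside T[vw; w], so the recursion is at most n deep.
  tour-below : ∀ K {anc : List (Fin n)} → Unique anc → n ≤ length anc + K →
               ∀ {v w} → w ∈ rot v → (∀ {a} → a ∈ anc → ¬ InComponent rot v w a) → Tour v w
  tour-below zero    {anc} u n≤ {v} {w} w∈ outside =
    ⊥-elim (<-irrefl refl (≤-trans (Unique⇒length≤ (w∉ ∷ u))
                                   (subst (n ≤_) (+-identityʳ (length anc)) n≤)))
    where w∉ = All.tabulate (λ a∈ w≡a → outside a∈ (subst (InComponent rot v w) w≡a here))
  tour-below (suc K) {anc} u n≤ {v} {w} w∈ outside = AroundVertex.around w∈ λ x∈ x≢v →
    tour-below K (w∉ ∷ u) (subst (n ≤_) (+-suc (length anc) K) n≤) x∈ (outside' x∈ x≢v)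
    where
    w∉ = All.tabulate (λ a∈ w≡a → outside a∈ (subst (InComponent rot v w) w≡a here))
    outside' : ∀ {x} → x ∈ rot w → x ≢ v → ∀ {a} → a ∈ w ∷ anc → ¬ InComponent rot w x a
    outside' x∈ x≢v (here refl) = no-return x∈
    outside' x∈ x≢v (there a∈)  = outside a∈ ∘ component-nested w∈ x∈ x≢v

  opaque
    tour : ∀ {v w} → w ∈ rot v → Tour v w
    tour w∈ = tour-below n [] ≤-refl w∈ λ ()

  module Orbit {v w : Fin n} (w∈ : w ∈ rot v) where
    a : CV n
    a = dart v w

    p : ℕ → CV n
    p e = a ⁺^ e

    p-valid : ∀ e → ValidCV rot (p e)
    p-valid e = ⁺^-valid e (dart-valid w∈)

    module out  = Tour (tour w∈)
    module back = Tour (tour (symmetric v w w∈))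

    p-out : p (suc out.steps) ≡ dart w v
    p-out = trans (sym (⁺^-suc a out.steps)) out.ends

    p-inside : ∀ {e} → 1 ≤ e → e ≤ suc out.steps → InComponent rot v w (proj₁ (p e))
    p-inside {suc e} _ (s≤s e≤) = subst (InComponent rot v w ∘ proj₁) (⁺^-suc a e) (out.inside e≤)

    visits-out : ∀ {y} → InComponent rot v w y → Σ ℕ λ e → e ≤ suc out.steps × proj₁ (p e) ≡ y
    visits-out y∈ = let (e , e≤ , eq) = out.covers y∈ in
                    suc e , s≤s e≤ , trans (cong proj₁ (sym (⁺^-suc a e))) eq

    visits-all : ∀ y → Σ ℕ λ e → proj₁ (p e) ≡ y
    visits-all y with component-cover v w y
    ... | inj₁ y∈ = let (e , _ , eq) = visits-out y∈ in e , eq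
    ... | inj₂ y∈ = let (e , _ , eq) = back.covers y∈ in
                    suc e + suc out.steps , trans (cong proj₁ (⁺^-concat (suc out.steps) e p-out refl)) eq

    opaque
      first-return : Σ ℕ λ m → p (suc m) ≡ a × (∀ {m'} → m' < m → p (suc m') ≢ a)
      first-return =
        let (m , _ , ret , min) = least (λ m → p (suc m) ≟CV a) {back.steps + suc out.steps}
                                    (⁺^-concat (suc out.steps) back.steps p-out back.ends)
        in m , ret , min

    M-1 : ℕ
    M-1 = proj₁ first-return

    -- the period of a under ⁺, i.e. the length of C_T
    M : ℕ
    M = suc M-1

    p-period : p M ≡ a
    p-period = proj₁ (proj₂ first-return)

    p-periodic : ∀ e → p (e + M) ≡ p e
    p-periodic e = trans (⁺^-+ a e M) (cong (_⁺^ e) p-period)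

    p-periodic* : ∀ r q → p (r + q * M) ≡ p r
    p-periodic* r zero    = cong p (+-identityʳ r)
    p-periodic* r (suc q) = begin
      p (r + (M + q * M))   ≡⟨ cong p (trans (cong (r +_) (+-comm M (q * M))) (sym (+-assoc r (q * M) M))) ⟩
      p (r + q * M + M)     ≡⟨ p-periodic (r + q * M) ⟩
      p (r + q * M)         ≡⟨ p-periodic* r q ⟩
      p r                   ∎
      where open ≡-Reasoning

    p-mod : ∀ e → p (e % M) ≡ p e
    p-mod e = trans (sym (p-periodic* (e % M) (e / M))) (cong p (sym (m≡m%n+[m/n]*n e M)))

    visits-window : ∀ i y → Σ ℕ λ e → i ≤ e × e ≤ i + M-1 × proj₁ (p e) ≡ y
    visits-window zero y =
      let (e , eq) = visits-all y in e % M , z≤n , ≤-pred (m%n<n e M) , trans (cong proj₁ (p-mod e)) eq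
    visits-window (suc i) y with visits-window i y
    ... | e , i≤e , e≤ , eq with m≤n⇒m<n∨m≡n i≤e
    ...   | inj₁ i<e  = e , i<e , m≤n⇒m≤1+n e≤ , eq
    ...   | inj₂ refl = i + M , ≤-trans (s≤s (m≤m+n i M-1)) (≤-reflexive (sym (+-suc i M-1))) ,
                        ≤-reflexive (+-suc i M-1) , trans (cong proj₁ (p-periodic i)) eq

    p-return⇒a-return : ∀ i δ → p i ⁺^ δ ≡ p i → a ⁺^ δ ≡ a
    p-return⇒a-return zero    δ eq = eq
    p-return⇒a-return (suc i) δ eq = p-return⇒a-return i δ
      (succ-injective (⁺^-valid δ (p-valid i)) (p-valid i) (trans (sym (⁺^-suc (p i) δ)) eq))

    p-distinct : ∀ i {δ} → 1 ≤ δ → δ < M → p (δ + i) ≢ p i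
    p-distinct i {suc δ} _ (s≤s δ<) eq =
      proj₂ (proj₂ first-return) δ< (p-return⇒a-return i (suc δ) (trans (sym (⁺^-+ a (suc δ) i)) eq))

    p-injective : ∀ {i j} → i < M → j < M → p i ≡ p j → i ≡ j
    p-injective {i} {j} i<M j<M eq with <-cmp i j
    ... | tri≈ _ i≡j _ = i≡j
    ... | tri< i<j _ _ = contradiction (trans (cong p (m∸n+n≡m (<⇒≤ i<j))) (sym eq))
                           (p-distinct i (m<n⇒0<n∸m i<j) (≤-<-trans (m∸n≤m j i) j<M))
    ... | tri> _ _ j<i = contradiction (trans (cong p (m∸n+n≡m (<⇒≤ j<i))) eq)
                           (p-distinct j (m<n⇒0<n∸m j<i) (≤-<-trans (m∸n≤m i j) i<M))

    M≤cycleLen : M ≤ cycleLen rot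
    M≤cycleLen = subst (M ≤_) (sym (*-distribˡ-∸ 2 n 1)) (m+n≤o⇒m≤o∸n M
      (injection⇒≤darts (p ∘ toℕ) (λ eq → FP.toℕ-injective (p-injective (FP.toℕ<n _) (FP.toℕ<n _) eq))
                        (p-valid ∘ toℕ)))

    walk-orbit : ∀ F d i → d ≤ F → d < M → walk rot F (p i) (p (d + i)) ≡ map p (range i d)
    walk-orbit zero    zero    i _        _   = refl
    walk-orbit (suc F) zero    i _        _ with p i ≟CV p i
    ... | yes _   = refl
    ... | no p≢p  = contradiction refl p≢p
    walk-orbit (suc F) (suc d) i (s≤s d≤F) d<M with p i ≟CV p (suc d + i)
    ... | yes eq = contradiction (sym eq) (p-distinct i (s≤s z≤n) d<M)
    ... | no _   = cong (p i ∷_) (trans (cong (walk rot F (p (suc i))) (cong p (sym (+-suc d i))))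
                                        (walk-orbit F d (suc i) d≤F (<-trans (n<1+n d) d<M)))

    seg-orbit : ∀ {i j} → i ≤ j → j ∸ i < M → seg rot (p i) (p j) ≡ map p (range i (j ∸ i))
    seg-orbit {i} {j} i≤j j-i<M = trans (cong (seg rot (p i) ∘ p) (sym (m∸n+n≡m i≤j)))
      (walk-orbit (cycleLen rot) (j ∸ i) i (≤-trans (<⇒≤ j-i<M) M≤cycleLen) j-i<M)

    ∈-seg-orbit : ∀ {i j e} → i ≤ j → j ∸ i < M → i ≤ e → e ≤ j → p e ∈ seg rot (p i) (p j)
    ∈-seg-orbit {i} {j} i≤j j-i<M i≤e e≤j = subst (p _ ∈_) (sym (seg-orbit i≤j j-i<M))
      (∈-map⁺ p (∈-range⁺ i≤e (subst (_ ≤_) (sym (m∸n+n≡m i≤j)) e≤j)))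

    inρ-orbit⁺ : ∀ {i j e} → i ≤ j → j ∸ i < M → i ≤ e → e ≤ j →
                 inρ rot (p i) (p j) (proj₁ (p e)) ≡ true
    inρ-orbit⁺ i≤j j-i<M i≤e e≤j = ∈⇒memB _ _ (∈-map⁺ proj₁ (∈-seg-orbit i≤j j-i<M i≤e e≤j))

    inρ-orbit⁻ : ∀ {i j y} → i ≤ j → j ∸ i < M → inρ rot (p i) (p j) y ≡ true →
                 Σ ℕ λ e → i ≤ e × e ≤ j × proj₁ (p e) ≡ y
    inρ-orbit⁻ {i} {j} {y} i≤j j-i<M y∈ with ∈-map⁻ proj₁ (memB⇒∈ y _ y∈)
    ... | x , x∈ , refl with ∈-map⁻ p (subst (x ∈_) (seg-orbit i≤j j-i<M) x∈)
    ...   | e , e∈ , refl = let (i≤e , e≤) = ∈-range⁻ e∈ in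
                            e , i≤e , subst (e ≤_) (m∸n+n≡m i≤j) e≤ , refl

module Weight {n : ℕ} (c : Fin n → ℕ) where

  weight : (Fin n → Bool) → Fin n → ℕ
  weight P y = if P y then c y else 0

  weight-mono : ∀ P Q y → (P y ≡ true → Q y ≡ true) → weight P y ≤ weight Q y
  weight-mono P Q y P⇒Q with P y | Q y | P⇒Q
  ... | true  | true  | _     = ≤-refl
  ... | true  | false | P⇒Q' = contradiction (P⇒Q' refl) λ ()
  ... | false | _     | _     = z≤n

  sum-weight-mono : ∀ P Q xs → (∀ y → P y ≡ true → Q y ≡ true) →
                    sum (map (weight P) xs) ≤ sum (map (weight Q) xs)
  sum-weight-mono P Q []       _   = z≤n
  sum-weight-mono P Q (x ∷ xs) P⇒Q = +-mono-≤ (weight-mono P Q x (P⇒Q x)) (sum-weight-mono P Q xs P⇒Q)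

  sum-weight-+ : ∀ P Q {y₀} xs → Unique xs → y₀ ∈ xs → (∀ y → P y ≡ true → Q y ≡ true) →
                 P y₀ ≡ false → Q y₀ ≡ true → sum (map (weight P) xs) + c y₀ ≤ sum (map (weight Q) xs)
  sum-weight-+ P Q (x ∷ xs) (_ ∷ u) (here refl) P⇒Q Px≡false Qx≡true
    rewrite Px≡false | Qx≡true =
    subst (_≤ c x + sum (map (weight Q) xs)) (+-comm (c x) _) (+-monoʳ-≤ (c x) (sum-weight-mono P Q xs P⇒Q))
  sum-weight-+ P Q (x ∷ xs) (_ ∷ u) (there y₀∈) P⇒Q Py₀ Qy₀ =
    subst (_≤ weight Q x + sum (map (weight Q) xs)) (sym (+-assoc (weight P x) _ _))
      (+-mono-≤ (weight-mono P Q x (P⇒Q x)) (sum-weight-+ P Q xs u y₀∈ P⇒Q Py₀ Qy₀))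

  sum-weight-≡0 : ∀ P xs → (∀ {y} → y ∈ xs → P y ≡ false) → sum (map (weight P) xs) ≡ 0
  sum-weight-≡0 P []       _      = refl
  sum-weight-≡0 P (x ∷ xs) ¬P rewrite ¬P (here refl) = sum-weight-≡0 P xs (¬P ∘ there)

  sum-weight-single : ∀ P {y₀} xs → Unique xs → (∀ y → P y ≡ true → y ≡ y₀) →
                      sum (map (weight P) xs) ≤ c y₀
  sum-weight-single P []       _        _    = z≤n
  sum-weight-single P (x ∷ xs) (x∉ ∷ u) only with P x in Px
  ... | false = sum-weight-single P xs u only
  ... | true  = ≤-reflexive (begin
    c x + sum (map (weight P) xs)   ≡⟨ cong (c x +_) (sum-weight-≡0 P xs (λ y∈ → ¬-not (λ Py →
                                         All.lookup x∉ y∈ (trans (only x Px) (sym (only _ Py)))))) ⟩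
    c x + 0                         ≡⟨ +-identityʳ (c x) ⟩
    c x                             ≡⟨ cong c (only x Px) ⟩
    c _                             ∎)
    where open ≡-Reasoning

  wt-mono : ∀ {P Q} → (∀ y → P y ≡ true → Q y ≡ true) → wt c P ≤ wt c Q
  wt-mono {P} {Q} = sum-weight-mono P Q (allFin n)

  wt-+ : ∀ {P Q y₀} → (∀ y → P y ≡ true → Q y ≡ true) → P y₀ ≡ false → Q y₀ ≡ true →
         wt c P + c y₀ ≤ wt c Q
  wt-+ {P} {Q} = sum-weight-+ P Q (allFin n) (allFin⁺ n) (∈-allFin _)

  wt-single : ∀ {P y₀} → (∀ y → P y ≡ true → y ≡ y₀) → wt c P ≤ c y₀
  wt-single {P} = sum-weight-single P (allFin n) (allFin⁺ n)

module _ {n : ℕ} {rot : RotSys n} {c : Fin n → ℕ} {k g : ℕ} (Ω : Omega rot c k g) where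

  not-overloaded⇒light : ∀ {x y} → ValidCV rot x → ValidCV rot y →
                         cseg rot c x y ≤ k → cseg rot c x y + g ≤ k
  not-overloaded⇒light {x} {y} x-valid y-valid ≤k with k + 1 ≤? cseg rot c x y + g
  ... | yes big = contradiction (big , ≤k) (Ω x y x-valid y-valid)
  ... | no ¬big = ≤-pred (subst (suc (cseg rot c x y + g) ≤_) (+-comm k 1) (≰⇒> ¬big))

  heavy⇒overloaded : ∀ {x y} → ValidCV rot x → ValidCV rot y →
                     k + 1 ≤ cseg rot c x y + g → k < cseg rot c x y
  heavy⇒overloaded {x} {y} x-valid y-valid big with cseg rot c x y ≤? k
  ... | yes ≤k = contradiction (big , ≤k) (Ω x y x-valid y-valid)
  ... | no ≰k  = ≰⇒> ≰k

module Overload {n : ℕ} {rot : RotSys n} (tree : IsTree rot) {c : Fin n → ℕ} (c≥1 : ∀ a → 1 ≤ c a)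
                {k g : ℕ} (c≤k : ∀ a → c a ≤ k) (Ω : Omega rot c k g)
                {v w : Fin n} (w∈ : w ∈ rot v) {C : Fin n → Bool}
                (C⇔ : ∀ a → (C a ≡ true) ⇔ InComponent rot v w a) (heavy : k ≤ wt c C + g) where
  open Tree rot tree
  open Orbit w∈
  open Weight c

  cs : ℕ → ℕ → ℕ
  cs i j = cseg rot c (p i) (p j)

  cs-light : ∀ i j → cs i j ≤ k → cs i j + g ≤ k
  cs-light i j = not-overloaded⇒light Ω (p-valid i) (p-valid j)

  cs-mono : ∀ {i j i' j'} → i ≤ j → j ∸ i < M → i' ≤ j' → j' ∸ i' < M →
            (∀ {e} → i ≤ e → e ≤ j → Σ ℕ λ e' → i' ≤ e' × e' ≤ j' × proj₁ (p e') ≡ proj₁ (p e)) →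
            cs i j ≤ cs i' j'
  cs-mono i≤j j-i<M i'≤j' j'-i'<M inside = wt-mono λ y y∈ →
    let (e , i≤e , e≤j , eq)       = inρ-orbit⁻ i≤j j-i<M y∈
        (e' , i'≤e' , e'≤j' , eq') = inside i≤e e≤j
    in subst (λ z → inρ rot (p _) (p _) z ≡ true) (trans eq' eq) (inρ-orbit⁺ i'≤j' j'-i'<M i'≤e' e'≤j')

  cs-sub : ∀ {i j i' j'} → i' ≤ i → i ≤ j → j ≤ j' → j' ∸ i' < M → cs i j ≤ cs i' j'
  cs-sub i'≤i i≤j j≤j' j'-i'<M = cs-mono i≤j (≤-<-trans (∸-mono j≤j' i'≤i) j'-i'<M)
    (≤-trans i'≤i (≤-trans i≤j j≤j')) j'-i'<M
    (λ {e} i≤e e≤j → e , ≤-trans i'≤i i≤e , ≤-trans e≤j j≤j' , refl)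

  cs-full : ∀ i {i' j'} → i' ≤ j' → j' ∸ i' < M → cs i' j' ≤ cs i (i + M-1)
  cs-full i i'≤j' j'-i'<M =
    cs-mono i'≤j' j'-i'<M (m≤m+n i M-1) (subst (_< M) (sym (m+n∸m≡n i M-1)) ≤-refl)
    (λ {e} _ _ → visits-window i (proj₁ (p e)))

  cs-periodic : ∀ i j → cs (i + M) (j + M) ≡ cs i j
  cs-periodic i j = cong₂ (cseg rot c) (p-periodic i) (p-periodic j)

  cs-single : ∀ i → cs i i ≤ k
  cs-single i = ≤-trans (wt-single λ y y∈ →
    let (e , i≤e , e≤i , eq) = inρ-orbit⁻ ≤-refl (subst (_< M) (sym (n∸n≡0 i)) (s≤s z≤n)) y∈
    in trans (sym eq) (cong (proj₁ ∘ p) (≤-antisym e≤i i≤e))) (c≤k _)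

  window< : ∀ {a b} → a < b → a + M ∸ b < M
  window< {a} {b} a<b = s≤s (≤-trans (∸-monoʳ-≤ (a + M) a<b)
    (≤-reflexive (trans (cong (_∸ suc a) (+-suc a M-1)) (m+n∸m≡n a M-1))))

  L : ℕ
  L = suc out.steps

  C-window : Σ ℕ λ D → D ≤ L × D < M × (∀ {y} → C y ≡ true → Σ ℕ λ e → e ≤ D × proj₁ (p e) ≡ y)
  C-window with L <? M
  ... | yes L<M = L , ≤-refl , L<M , λ y∈ → visits-out (Equivalence.to (C⇔ _) y∈)
  ... | no L≮M  = M-1 , ≤-pred (≤-trans (≮⇒≥ L≮M) (n≤1+n L)) , ≤-refl ,
                  λ {y} _ → let (e , _ , e≤ , eq) = visits-window 0 y in e , e≤ , eq

  C+v≤window : ∀ {D} → D < M → (∀ {y} → C y ≡ true → Σ ℕ λ e → e ≤ D × proj₁ (p e) ≡ y) →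
               wt c C + c v ≤ cs 0 D
  C+v≤window D<M covers = wt-+
    (λ y y∈ → let (e , e≤D , eq) = covers y∈ in
              subst (λ z → inρ rot (p 0) (p _) z ≡ true) eq (inρ-orbit⁺ z≤n D<M z≤n e≤D))
    (¬-not λ v∈ → v∉component w∈ (Equivalence.to (C⇔ v) v∈))
    (inρ-orbit⁺ z≤n D<M z≤n z≤n)

  window-overloaded : Σ ℕ λ D → D ≤ L × D < M × k < cs 0 D
  window-overloaded =
    let (D , D≤L , D<M , covers) = C-window in
    D , D≤L , D<M , heavy⇒overloaded Ω (p-valid 0) (p-valid D) (begin
      k + 1                   ≤⟨ +-mono-≤ heavy (c≥1 v) ⟩
      wt c C + g + c v        ≡⟨ +-assoc (wt c C) g (c v) ⟩
      wt c C + (g + c v)      ≡⟨ cong (wt c C +_) (+-comm g (c v)) ⟩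
      wt c C + (c v + g)      ≡⟨ +-assoc (wt c C) (c v) g ⟨
      wt c C + c v + g        ≤⟨ +-monoˡ-≤ g (C+v≤window D<M covers) ⟩
      cs 0 D + g              ∎)
    where open ≤-Reasoning

  opaque
    first-overload : Σ ℕ λ d → suc d ≤ L × suc d < M × k < cs 0 (suc d) × cs 0 d + g ≤ k
    first-overload with window-overloaded
    ... | D , D≤L , D<M , over with least (λ d → k <? cs 0 d) {D} over
    ...   | zero  , _   , over₀ , _   = contradiction (cs-single 0) (<⇒≱ over₀)
    ...   | suc d , d<D , over' , min =
            d , ≤-trans d<D D≤L , ≤-<-trans d<D D<M , over' , cs-light 0 d (≮⇒≥ (min ≤-refl))

  module AtFirstOverload {d : ℕ} (1+d≤L : suc d ≤ L) (1+d<M : suc d < M)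
                         (overload : k < cs 0 (suc d)) (short : cs 0 d + g ≤ k) where

    opaque
      discharge : Σ ℕ λ e → e ≤ d × k < cs e (suc d) × cs (suc e) (suc d) + g ≤ k
      discharge with least (λ e → cs (suc e) (suc d) ≤? k) {d} (cs-single (suc d))
      ... | zero  , _   , light , _   = 0 , z≤n , overload , cs-light 1 (suc d) light
      ... | suc e , e<d , light , min =
            suc e , e<d , ≰⇒> (min ≤-refl) , cs-light (suc (suc e)) (suc d) light

    full-overloaded : k < cs (suc d) (d + M)
    full-overloaded =
      let (D , _ , D<M , over) = window-overloaded in
      <-≤-trans over
        (subst (λ z → cs 0 D ≤ cs (suc d) z) (sym (+-suc d M-1)) (cs-full (suc d) z≤n D<M))

    overloaded-from : ∀ {t} → suc d ≤ t →
                      (∀ {t'} → t' < t → ¬ (suc d ≤ t' × cs (suc t') (d + M) ≤ k)) →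
                      k < cs t (d + M)
    overloaded-from 1+d≤t min with m≤n⇒m<n∨m≡n 1+d≤t
    ... | inj₂ refl          = full-overloaded
    ... | inj₁ (s≤s 1+d≤t') = ≰⇒> λ light → min ≤-refl (1+d≤t' , light)

    opaque
      start : Σ ℕ λ t → suc d ≤ t × t < M × k < cs t (d + M) × cs (suc t) (d + M) + g ≤ k
      start with least (λ t → suc d ≤? t ×-dec cs (suc t) (d + M) ≤? k) {M-1}
                   (≤-pred 1+d<M , subst (_≤ k) (sym (cs-periodic 0 d)) (≤-trans (m≤m+n _ g) short))
      ... | t , t≤ , (1+d≤t , light) , min =
            t , 1+d≤t , s≤s t≤ , overloaded-from 1+d≤t min , cs-light (suc t) (d + M) light

    quadruple : ∀ {e t} → e ≤ d → k < cs e (suc d) → cs (suc e) (suc d) + g ≤ k →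
                suc d ≤ t → t < M → k < cs t (d + M) → cs (suc t) (d + M) + g ≤ k →
                MaxQuadData rot c k g (p (suc t)) (p (suc d)) (p e)
    quadruple {e} {t} e≤d e-over e-under 1+d≤t t<M t-over t-under = record
      { u-valid  = p-valid (suc t)
      ; v-valid  = p-valid (suc d)
      ; short    = subst (λ z → cseg rot c (p (suc t)) z + g ≤ k) (sym v⁻≡) t-under
      ; overload = <-≤-trans overload (begin
          cs 0 (suc d)             ≡⟨ cs-periodic 0 (suc d) ⟨
          cs M (suc d + M)         ≤⟨ cs-sub t<M (m≤n+m M (suc d)) ≤-refl (window< (s≤s 1+d≤t)) ⟩
          cs (suc t) (suc d + M)   ≡⟨ cong (cseg rot c (p (suc t))) (p-periodic (suc d)) ⟩
          cs (suc t) (suc d)       ∎)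
      ; maximal  = subst₂ (λ x y → k < cseg rot c x y) (sym (pred-succ (p-valid t))) (sym v⁻≡) t-over
      ; w-on     = subst (λ z → p e ∈ seg rot (p (suc t)) z) (sym v⁻≡)
                     (subst (_∈ seg rot (p (suc t)) (p (d + M))) (p-periodic e)
                       (∈-seg-orbit (≤-trans t<M (m≤n+m M d)) (window< (m≤n⇒m≤1+n 1+d≤t))
                                    (≤-trans t<M (m≤n+m M e)) (+-monoˡ-≤ M e≤d)))
      ; w-over   = e-over
      ; w-under  = e-under
      }
      where
      open ≤-Reasoning
      v⁻≡ : predCV rot (p (suc d)) ≡ p (d + M)
      v⁻≡ = trans (pred-succ (p-valid d)) (sym (p-periodic d))

    v-covered : ∀ {e t} → e ≤ d → suc d ≤ t → t < M →
                Q-M rot c (p (suc t)) (p (suc d)) (p e) v ⊎ v ≡ Q-n rot c (p e)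
    v-covered {zero}  _     _      _   = inj₂ refl
    v-covered {suc e} {t} e<d 1+d≤t t<M = inj₁ (v∈S , v∉[w,v])
      where
      v∈S : inρ rot (p (suc t)) (p (suc d)) v ≡ true
      v∈S = subst₂ (λ z y → inρ rot (p (suc t)) z y ≡ true) (p-periodic (suc d)) (cong proj₁ p-period)
              (inρ-orbit⁺ (≤-trans t<M (m≤n+m M (suc d))) (window< (s≤s 1+d≤t)) t<M (m≤n+m M (suc d)))
      v∉[w,v] : inρ rot (p (suc e)) (p (suc d)) v ≡ false
      v∉[w,v] = ¬-not λ v∈ →
        let (e' , 1+e≤e' , e'≤1+d , eq) =
              inρ-orbit⁻ (m≤n⇒m≤1+n e<d) (≤-<-trans (m∸n≤m (suc d) (suc e)) 1+d<M) v∈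
        in v∉component w∈ (subst (InComponent rot v w) eq
             (p-inside (≤-trans (s≤s z≤n) 1+e≤e') (≤-trans e'≤1+d 1+d≤L)))

lemma3 : (n : ℕ) (rot : RotSys n) → IsTree rot →
    (c : Fin n → ℕ) → (∀ a → 1 ≤ c a) →
    (k g : ℕ) → 1 ≤ k → 1 ≤ g → k ≤ wt c (λ _ → true) →
    (∀ a → c a ≤ k) →
    Omega rot c k g →
    (v w : Fin n) → w ∈ rot v →
    (C : Fin n → Bool) → (∀ a → (C a ≡ true) ⇔ InComponent rot v w a) →
    k ≤ wt c C + g →
    CoveredByMaxQuad rot c k g v
lemma3 n rot tree c c≥1 k g _ _ _ c≤k Ω v w w∈ C C⇔ heavy =
  let (d , 1+d≤L , 1+d<M , overload , short) = first-overload
      open AtFirstOverload 1+d≤L 1+d<M overload short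
      (e , e≤d , e-over , e-under)            = discharge
      (t , 1+d≤t , t<M , t-over , t-under)    = start
  in p (suc t) , p (suc d) , p e ,
     quadruple e≤d e-over e-under 1+d≤t t<M t-over t-under , v-covered e≤d 1+d≤t t<M
  where open Overload tree c≥1 c≤k Ω w∈ C⇔ heavy
        open Tree.Orbit rot tree w∈ using (p)
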